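{- Consider a nontrivial $m$-cycle of $C$ with local minima $n_1,\dots,n_m$ (indices extended periodically). For every integer $m_1\geq 0$, $\sum_{i=1}^{m_1}T(n_i)<\frac{35m_1+19}{18}\cdot\frac{1}{X_0}.$
   Context: $C(n)=n/2$ for even $n$, $C(n)=(3n+1)/2$ for odd $n$ (on positive integers); $C^t$ is the $t$-fold iterate. A nontrivial cycle is a set $\{n,C(n),\dots,C^{p-1}(n)\}$ with $C^p(n)=n$, different from $\{1,2\}$. A local minimum of the cycle is an element smaller than its predecessor and successor along the cycle (equivalently, an odd element whose predecessor is even). An $m$-cycle is a nontrivial cycle with exactly $m$ local minima; list them as $n_1,\dots,n_m$ in order of appearance along the cycle (starting at any of them) and set $n_{i+m}:=n_i$. For each $i$, $k_i\geq1$ is such that $n_i,C(n_i),\dots,C^{k_i-1}(n_i)$ are odd and $C^{k_i}(n_i)$ is even. Define $T(n_i):=\sum_{t=0}^{k_i-1}\frac{1}{C^t(n_i)}$. $X_0$ is a positive integer with $X_0>765$ such that for every positive integer $n\leq X_0$ the sequence $n,C(n),C^2(n),\dots$ eventually reaches $1$. -}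

module Defs where

open import Data.Nat using (ℕ; zero; suc; _+_; _*_; _∸_; _<_; _≤_; _%_; _/_; _≡ᵇ_)
open import Data.Bool using (if_then_else_)
open import Data.Integer using (+_)
open import Data.Rational as ℚ using (ℚ; 0ℚ)
open import Data.Product using (_×_; ∃-syntax)
open import Data.Sum using (_⊎_)
open import Relation.Binary.PropositionalEquality using (_≡_)
open import Relation.Nullary using (¬_)

Even : ℕ → Set
Even n = n % 2 ≡ 0

Odd : ℕ → Set
Odd n = n % 2 ≡ 1

C : ℕ → ℕ
C n = if n % 2 ≡ᵇ 0 then n / 2 else (3 * n + 1) / 2

iter : ℕ → ℕ → ℕ
iter zero    n = n
iter (suc t) n = C (iter t n)

-- x lies on a cycle of length p:  x ≥ 1, p ≥ 1, C^p(x) = x.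
-- The cycle is the set {C^t(x) : t ∈ ℕ}.
OnCycle : ℕ → ℕ → Set
OnCycle x p = 1 ≤ x × 1 ≤ p × iter p x ≡ x

InCycle : ℕ → ℕ → Set
InCycle y x = ∃[ t ] iter t x ≡ y

-- the cycle through x is different (as a set) from {1,2}
NonTrivial : ℕ → Set
NonTrivial x =
  ¬ ((∀ t → iter t x ≡ 1 ⊎ iter t x ≡ 2) × InCycle 1 x × InCycle 2 x)

-- position t on the cycle (x of period p) is a local minimum: the element
-- C^t(x) is smaller than its predecessor C^(t+p-1)(x) and its successor.
IsLocalMinAt : ℕ → ℕ → ℕ → Set
IsLocalMinAt x p t = iter t x < iter (t + p ∸ 1) x × iter t x < iter (suc t) x

-- k is the k_i of n:  k ≥ 1, n, C(n), …, C^(k-1)(n) odd, C^k(n) even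
IsOddRun : ℕ → ℕ → Set
IsOddRun n k = 1 ≤ k × (∀ t → t < k → Odd (iter t n)) × Even (iter k n)

-- 1/d as a rational (convention 1/0 := 0; only used for positive d)
inv : ℕ → ℚ
inv zero    = 0ℚ
inv (suc d) = + 1 ℚ./ suc d

sumTo : ℕ → (ℕ → ℚ) → ℚ
sumTo zero    f = 0ℚ
sumTo (suc m) f = sumTo m f ℚ.+ f m

T : ℕ → ℕ → ℚ
T n k = sumTo k (λ t → inv (iter t n))

{-# OPTIONS --safe #-}
-- Every element of a nontrivial cycle exceeds X₀: an orbit entering [1, X₀] reaches 1, and then
-- the cycle would be {1, 2}. Along the odd run n, C n, …, C^(k-1) n of a local minimum n we have
-- 2 C m = 3 m + 1, so the terms 1/C^t(n) decay at least geometrically with ratio 2/3 and T(n) < 3/n.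
-- Let N = C^(k+1)(n). If N is even, write n = 2z + 1: the orbit of z runs alongside that of n and
-- C^(k+1)(z) = C^(k+2)(n), so z > X₀ and 3 T(n) < 9/n < 5/X₀. If N is odd it is the next local
-- minimum; a run with k ≤ 2 gives 3 T(n) ≤ 5/n, while a longer run grows enough that
-- 9 (T(n) + T(N)) ≤ 35/n. Pairing each long run with its successor gives 18 Σ T ≤ 35 m / X₀, and a
-- long run left unpaired at the end costs 18 · 3/X₀ = (35 + 19)/X₀.
module Submission where

open import Data.Bool using (if_then_else_)
open import Data.Empty using (⊥; ⊥-elim)
open import Data.Integer as ℤ using (+_)
open import Data.Product using (_×_; _,_; proj₁; proj₂; ∃-syntax)
open import Data.Rational as ℚ using (ℚ)
open import Data.Sum using (_⊎_; inj₁; inj₂)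
open import Function using (_∘_)
open import Relation.Binary.PropositionalEquality
open import Relation.Nullary using (¬_; yes; no; contradiction)
open import Defs

module Collatz where

  open import Data.Nat using (ℕ; zero; suc; _+_; _*_; _%_; _/_; _≡ᵇ_; _<_; _≤_; z≤n; s≤s)
  open import Data.Nat.DivMod using (m*n%n≡0; [m+kn]%n≡m%n; m*n/n≡m)
  open import Data.Nat.Properties
  import Data.Nat.Tactic.RingSolver as ℕ-Ring

  data Parity : ℕ → Set where
    even : ∀ w → Parity (2 * w)
    odd  : ∀ w → Parity (1 + 2 * w)

  parity : ∀ n → Parity n
  parity zero = even 0
  parity (suc n) with parity n
  ... | even w = odd w
  ... | odd w = subst Parity (*-suc 2 w) (even (suc w))

  even-2* : ∀ w → Even (2 * w)
  even-2* w = subst (λ n → n % 2 ≡ 0) (*-comm w 2) (m*n%n≡0 w 2)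

  odd-1+2* : ∀ w → Odd (1 + 2 * w)
  odd-1+2* w = subst (λ n → (1 + n) % 2 ≡ 1) (*-comm w 2) ([m+kn]%n≡m%n 1 w 2)

  even-odd-disjoint : ∀ n → Even n → Odd n → ⊥
  even-odd-disjoint _ e o with trans (sym e) o
  ... | ()

  even⊎odd : ∀ n → Even n ⊎ Odd n
  even⊎odd n with parity n
  ... | even w = inj₁ (even-2* w)
  ... | odd w = inj₂ (odd-1+2* w)

  odd⇒1+2* : ∀ {n} → Odd n → ∃[ z ] n ≡ 1 + 2 * z
  odd⇒1+2* {n} o with parity n
  ... | even w = ⊥-elim (even-odd-disjoint (2 * w) (even-2* w) o)
  ... | odd w = w , refl

  C-2* : ∀ w → C (2 * w) ≡ w
  C-2* w = begin
    C (2 * w)  ≡⟨ cong (λ r → if r ≡ᵇ 0 then 2 * w / 2 else (3 * (2 * w) + 1) / 2) (even-2* w) ⟩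
    2 * w / 2  ≡⟨ cong (_/ 2) (*-comm 2 w) ⟩
    w * 2 / 2  ≡⟨ m*n/n≡m w 2 ⟩
    w          ∎
    where open ≡-Reasoning

  C-1+2* : ∀ w → C (1 + 2 * w) ≡ 2 + 3 * w
  C-1+2* w = begin
    C (1 + 2 * w)              ≡⟨ cong (λ r → if r ≡ᵇ 0 then (1 + 2 * w) / 2 else (3 * (1 + 2 * w) + 1) / 2)
                                       (odd-1+2* w) ⟩
    (3 * (1 + 2 * w) + 1) / 2  ≡⟨ cong (_/ 2) (lemma w) ⟩
    (2 + 3 * w) * 2 / 2        ≡⟨ m*n/n≡m (2 + 3 * w) 2 ⟩
    2 + 3 * w                  ∎
    where
    open ≡-Reasoning
    lemma : ∀ w → 3 * (1 + 2 * w) + 1 ≡ (2 + 3 * w) * 2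
    lemma = ℕ-Ring.solve-∀

  C-odd : ∀ {n} → Odd n → 2 * C n ≡ 3 * n + 1
  C-odd {n} o with parity n
  ... | even w = ⊥-elim (even-odd-disjoint (2 * w) (even-2* w) o)
  ... | odd w = trans (cong (2 *_) (C-1+2* w)) (lemma w)
    where
    lemma : ∀ w → 2 * (2 + 3 * w) ≡ 3 * (1 + 2 * w) + 1
    lemma = ℕ-Ring.solve-∀

  C-even : ∀ {n} → Even n → 2 * C n ≡ n
  C-even {n} e with parity n
  ... | even w = cong (2 *_) (C-2* w)
  ... | odd w = ⊥-elim (even-odd-disjoint (1 + 2 * w) e (odd-1+2* w))

  odd⇒<C : ∀ {n} → Odd n → n < C n
  odd⇒<C {n} o with parity n
  ... | even w = ⊥-elim (even-odd-disjoint (2 * w) (even-2* w) o)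
  ... | odd w = subst (1 + 2 * w <_) (sym (C-1+2* w)) (+-monoʳ-≤ 2 (*-monoˡ-≤ w {2} {3} (s≤s (s≤s z≤n))))

  even⇒C< : ∀ {n} → Even n → 1 ≤ n → C n < n
  even⇒C< {n} e n≥1 with parity n
  ... | odd w = ⊥-elim (even-odd-disjoint (1 + 2 * w) e (odd-1+2* w))
  ... | even (suc w) = subst (_< 2 * suc w) (sym (C-2* (suc w))) (m<m+n (suc w) (s≤s z≤n))

  C-pos : ∀ {n} → 1 ≤ n → 1 ≤ C n
  C-pos {n} n≥1 with parity n
  ... | even (suc w) = subst (1 ≤_) (sym (C-2* (suc w))) (s≤s z≤n)
  ... | odd w = subst (1 ≤_) (sym (C-1+2* w)) (s≤s z≤n)

  iter-+ : ∀ s t n → iter (s + t) n ≡ iter s (iter t n)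
  iter-+ zero t n = refl
  iter-+ (suc s) t n = cong C (iter-+ s t n)

  iter-pos : ∀ {n} → 1 ≤ n → ∀ t → 1 ≤ iter t n
  iter-pos n≥1 zero = n≥1
  iter-pos n≥1 (suc t) = C-pos (iter-pos n≥1 t)

  iter-of-0 : ∀ t → iter t 0 ≡ 0
  iter-of-0 zero = refl
  iter-of-0 (suc t) = cong C (iter-of-0 t)

  orbit-of-1 : ∀ d → iter d 1 ≡ 1 ⊎ iter d 1 ≡ 2
  orbit-of-1 zero = inj₁ refl
  orbit-of-1 (suc d) with orbit-of-1 d
  ... | inj₁ e = inj₂ (cong C e)
  ... | inj₂ e = inj₁ (cong C e)

  odd-2+3* : ∀ z → Odd (2 + 3 * z) → 2 + 3 * z ≡ 1 + 2 * C z
  odd-2+3* z o with parity z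
  ... | even w = ⊥-elim (even-odd-disjoint (2 + 3 * (2 * w)) (subst Even (eq w) (even-2* (1 + 3 * w))) o)
    where
    eq : ∀ w → 2 * (1 + 3 * w) ≡ 2 + 3 * (2 * w)
    eq = ℕ-Ring.solve-∀
  ... | odd w = trans (eq w) (cong (λ r → 1 + 2 * r) (sym (C-1+2* w)))
    where
    eq : ∀ w → 2 + 3 * (1 + 2 * w) ≡ 1 + 2 * (2 + 3 * w)
    eq = ℕ-Ring.solve-∀

  even-1+3* : ∀ w → Even (1 + 3 * w) → C w ≡ C (1 + 3 * w)
  even-1+3* w e with parity w
  ... | even v = ⊥-elim (even-odd-disjoint (1 + 3 * (2 * v)) e (subst Odd (eq v) (odd-1+2* (3 * v))))
    where
    eq : ∀ v → 1 + 2 * (3 * v) ≡ 1 + 3 * (2 * v)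
    eq = ℕ-Ring.solve-∀
  ... | odd v = trans (C-1+2* v) (sym (trans (cong C (eq v)) (C-2* (2 + 3 * v))))
    where
    eq : ∀ v → 1 + 3 * (1 + 2 * v) ≡ 2 * (2 + 3 * v)
    eq = ℕ-Ring.solve-∀

  even-2+3* : ∀ z → Even (2 + 3 * z) → Even (C (2 + 3 * z)) → C (C z) ≡ C (C (2 + 3 * z))
  even-2+3* z e e′ with parity z
  ... | odd w = ⊥-elim (even-odd-disjoint (2 + 3 * (1 + 2 * w)) e (subst Odd (eq w) (odd-1+2* (2 + 3 * w))))
    where
    eq : ∀ w → 1 + 2 * (2 + 3 * w) ≡ 2 + 3 * (1 + 2 * w)
    eq = ℕ-Ring.solve-∀
  ... | even w = begin
    C (C (2 * w))            ≡⟨ cong C (C-2* w) ⟩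
    C w                      ≡⟨ even-1+3* w (subst Even C-2+6w e′) ⟩
    C (1 + 3 * w)            ≡⟨ cong C C-2+6w ⟨
    C (C (2 + 3 * (2 * w)))  ∎
    where
    open ≡-Reasoning
    eq : ∀ w → 2 + 3 * (2 * w) ≡ 2 * (1 + 3 * w)
    eq = ℕ-Ring.solve-∀
    C-2+6w : C (2 + 3 * (2 * w)) ≡ 1 + 3 * w
    C-2+6w = trans (cong C (eq w)) (C-2* (1 + 3 * w))

  C-1+2*-odd : ∀ z → Odd (C (1 + 2 * z)) → C (1 + 2 * z) ≡ 1 + 2 * C z
  C-1+2*-odd z o = trans (C-1+2* z) (odd-2+3* z (subst Odd (C-1+2* z) o))

  C-1+2*-even² : ∀ z → Even (C (1 + 2 * z)) → Even (C (C (1 + 2 * z))) → C (C z) ≡ C (C (C (1 + 2 * z)))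
  C-1+2*-even² z e e′ = trans (even-2+3* z (subst Even (C-1+2* z) e) (subst (Even ∘ C) (C-1+2* z) e′))
                               (cong (C ∘ C) (sym (C-1+2* z)))

  iter-1+2* : ∀ z {K} → (∀ t → t < K → Odd (iter t (1 + 2 * z))) →
              ∀ t → t < K → iter t (1 + 2 * z) ≡ 1 + 2 * iter t z
  iter-1+2* z odds zero _ = refl
  iter-1+2* z odds (suc t) t+1<K =
    trans (cong C ih) (C-1+2*-odd (iter t z) (subst (Odd ∘ C) ih (odds (suc t) t+1<K)))
    where
    ih : iter t (1 + 2 * z) ≡ 1 + 2 * iter t z
    ih = iter-1+2* z odds t (<⇒≤ t+1<K)

  orbit-of-half-merges : ∀ z {K} → IsOddRun (1 + 2 * z) K → Even (iter (suc K) (1 + 2 * z)) →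
                         iter (suc K) z ≡ iter (suc (suc K)) (1 + 2 * z)
  orbit-of-half-merges z {zero} (() , _)
  orbit-of-half-merges z {suc j} (_ , odds , even-K) even-K+1 =
    trans (C-1+2*-even² (iter j z) (subst (Even ∘ C) e even-K) (subst (Even ∘ C ∘ C) e even-K+1))
          (cong (C ∘ C ∘ C) (sym e))
    where
    e : iter j (1 + 2 * z) ≡ 1 + 2 * iter j z
    e = iter-1+2* z odds j (n<1+n j)

  run-3≤2 : ∀ {y K t} → IsOddRun y K → t < K → 3 * iter t y ≤ 2 * iter (suc t) y
  run-3≤2 {y} {t = t} (_ , odds , _) t<K =
    subst (3 * iter t y ≤_) (sym (C-odd {iter t y} (odds t t<K))) (m≤m+n (3 * iter t y) 1)

  run-mono : ∀ {y K s t} → IsOddRun y K → s ≤ t → t < K → iter s y ≤ iter t y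
  run-mono {t = zero} run z≤n _ = ≤-refl
  run-mono {y} {K} {t = suc t} run s≤t+1 t+1<K with m≤n⇒m<n∨m≡n s≤t+1
  ... | inj₂ refl = ≤-refl
  ... | inj₁ (s≤s s≤t) = ≤-trans (run-mono run s≤t t<K) (*-cancelˡ-≤ 2 2c≤2c′)
    where
    t<K : t < K
    t<K = <⇒≤ t+1<K
    2c≤2c′ : 2 * iter t y ≤ 2 * iter (suc t) y
    2c≤2c′ = ≤-trans (*-monoˡ-≤ (iter t y) {2} {3} (s≤s (s≤s z≤n))) (run-3≤2 run t<K)

  run-9≤4 : ∀ {y K} → IsOddRun y K → 2 < K → 9 * y ≤ 4 * iter 2 y
  run-9≤4 {y} {K} run 2<K = begin
    9 * y                ≡⟨ *-assoc 3 3 y ⟩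
    3 * (3 * y)          ≤⟨ *-monoʳ-≤ 3 (run-3≤2 run (<-trans (s≤s z≤n) 1<K)) ⟩
    3 * (2 * iter 1 y)   ≡⟨ trans (sym (*-assoc 3 2 (iter 1 y))) (*-assoc 2 3 (iter 1 y)) ⟩
    2 * (3 * iter 1 y)   ≤⟨ *-monoʳ-≤ 2 (run-3≤2 run 1<K) ⟩
    2 * (2 * iter 2 y)   ≡⟨ *-assoc 2 2 (iter 2 y) ⟨
    4 * iter 2 y         ∎
    where
    open ≤-Reasoning
    1<K : 1 < K
    1<K = <-trans (s≤s (s≤s z≤n)) 2<K

  run-end : ∀ {y j} → IsOddRun y (suc j) → 3 * iter j y ≤ 4 * iter (2 + j) y
  run-end {y} {j} run@(_ , _ , even-K) = begin
    3 * iter j y              ≤⟨ run-3≤2 run (n<1+n j) ⟩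
    2 * iter (suc j) y        ≡⟨ cong (2 *_) (C-even {iter (suc j) y} even-K) ⟨
    2 * (2 * iter (2 + j) y)  ≡⟨ *-assoc 2 2 (iter (2 + j) y) ⟨
    4 * iter (2 + j) y        ∎
    where open ≤-Reasoning

module Estimates where

  open import Agda.Builtin.FromNat using (Number; fromNat)
  open import Data.Nat as ℕ using (ℕ; zero; suc; z≤n; s≤s)
  import Data.Nat.Literals as ℕ
  import Data.Nat.Properties as ℕ
  import Data.Integer.Properties as ℤₚ
  import Data.Integer.Tactic.RingSolver as ℤ-Ring
  import Data.Nat.Tactic.RingSolver as ℕ-Ring
  open import Data.Rational using (0ℚ; _+_; _*_; _/_; _≤_; _<_; _≤?_; toℚᵘ; NonNegative; nonNegative)
  open import Data.Rational.Literals using (number)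
  open import Data.Rational.Properties
  open import Data.Rational.Unnormalised as ℚᵘ using (mkℚᵘ; _≃_; *≡*; *≤*)
  import Data.Rational.Unnormalised.Properties as ℚᵘ
  open import Data.Unit.Base using (tt)
  open import Level using (0ℓ)
  open import Relation.Nullary.Decidable using (dec⇒maybe; from-yes)
  open import Tactic.RingSolver using (solve-∀)
  open import Tactic.RingSolver.Core.AlmostCommutativeRing using (AlmostCommutativeRing; fromCommutativeRing)
  open Collatz

  instance
    ℕ-number : Number ℕ
    ℕ-number = ℕ.number
    ℚ-number : Number ℚ
    ℚ-number = number

  private
    ℚ-ring : AlmostCommutativeRing 0ℓ 0ℓ
    ℚ-ring = fromCommutativeRing +-*-commutativeRing (λ q → dec⇒maybe (0ℚ ≟ q))

  fromℕ : ℕ → ℚ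
  fromℕ n = + n / 1

  toℚᵘ-/ : ∀ n d → toℚᵘ (+ n / suc d) ≃ mkℚᵘ (+ n) d
  toℚᵘ-/ n d = toℚᵘ-fromℚᵘ (mkℚᵘ (+ n) d)

  fromℕ-+ : ∀ m n → fromℕ (m ℕ.+ n) ≡ fromℕ m + fromℕ n
  fromℕ-+ m n = toℚᵘ-injective (begin-equality
    toℚᵘ (fromℕ (m ℕ.+ n))               ≃⟨ toℚᵘ-/ (m ℕ.+ n) 0 ⟩
    mkℚᵘ (+ (m ℕ.+ n)) 0                 ≃⟨ *≡* (cong (ℤ._* + 1) (trans (ℤₚ.pos-+ m n) (lemma (+ m) (+ n))))
                                          ⟩
    mkℚᵘ (+ m) 0 ℚᵘ.+ mkℚᵘ (+ n) 0       ≃⟨ ℚᵘ.+-cong (toℚᵘ-/ m 0) (toℚᵘ-/ n 0) ⟨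
    toℚᵘ (fromℕ m) ℚᵘ.+ toℚᵘ (fromℕ n)   ≃⟨ toℚᵘ-homo-+ (fromℕ m) (fromℕ n) ⟨
    toℚᵘ (fromℕ m + fromℕ n)             ∎)
    where
    open ℚᵘ.≤-Reasoning
    lemma : ∀ i j → i ℤ.+ j ≡ i ℤ.* + 1 ℤ.+ j ℤ.* + 1
    lemma = ℤ-Ring.solve-∀

  fromℕ-*-inv : ∀ p b → fromℕ p * inv (suc b) ≡ + p / suc b
  fromℕ-*-inv p b = toℚᵘ-injective (begin-equality
    toℚᵘ (fromℕ p * inv (suc b))             ≃⟨ toℚᵘ-homo-* (fromℕ p) (inv (suc b)) ⟩
    toℚᵘ (fromℕ p) ℚᵘ.* toℚᵘ (inv (suc b))   ≃⟨ ℚᵘ.*-cong (toℚᵘ-/ p 0) (toℚᵘ-/ 1 b) ⟩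
    mkℚᵘ (+ p) 0 ℚᵘ.* mkℚᵘ (+ 1) b           ≃⟨ *≡* eq ⟩
    mkℚᵘ (+ p) b                             ≃⟨ toℚᵘ-/ p b ⟨
    toℚᵘ (+ p / suc b)                       ∎)
    where
    open ℚᵘ.≤-Reasoning
    eq : (+ p ℤ.* + 1) ℤ.* + suc b ≡ + p ℤ.* + suc (b ℕ.+ 0)
    eq rewrite ℕ.+-identityʳ b = cong (ℤ._* + suc b) (ℤₚ.*-identityʳ (+ p))

  cross-≤ : ∀ p q {a b} → 1 ℕ.≤ a → 1 ℕ.≤ b → p ℕ.* a ℕ.≤ q ℕ.* b →
            fromℕ p * inv b ≤ fromℕ q * inv a
  cross-≤ p q {suc a} {suc b} _ _ pa≤qb =
    subst₂ _≤_ (sym (fromℕ-*-inv p b)) (sym (fromℕ-*-inv q a)) (toℚᵘ-cancel-≤ (begin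
      toℚᵘ (+ p / suc b)  ≃⟨ toℚᵘ-/ p b ⟩
      mkℚᵘ (+ p) b        ≤⟨ *≤* (subst₂ ℤ._≤_ (ℤₚ.pos-* p (suc a)) (ℤₚ.pos-* q (suc b)) (ℤ.+≤+ pa≤qb)) ⟩
      mkℚᵘ (+ q) a        ≃⟨ toℚᵘ-/ q a ⟨
      toℚᵘ (+ q / suc a)  ∎))
    where open ℚᵘ.≤-Reasoning

  *inv-antitone : ∀ q {a b} → 1 ℕ.≤ a → a ℕ.≤ b → fromℕ q * inv b ≤ fromℕ q * inv a
  *inv-antitone q a-pos a≤b = cross-≤ q q a-pos (ℕ.≤-trans a-pos a≤b) (ℕ.*-monoʳ-≤ q a≤b)

  inv-pos : ∀ {a} → 1 ℕ.≤ a → 0ℚ < inv a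
  inv-pos {suc a} _ = positive⁻¹ (inv (suc a)) {{normalize-pos 1 (suc a)}}

  sumTo-ratio-bound : ∀ (u : ℕ → ℚ) j → (∀ t → t ℕ.< j → 3 * u (suc t) ≤ 2 * u t) →
                      sumTo (suc j) u + 2 * u j ≤ 3 * u 0
  sumTo-ratio-bound u zero _ = ≤-reflexive (lemma (u 0))
    where
    lemma : ∀ a → 0ℚ + a + 2 * a ≡ 3 * a
    lemma = solve-∀ ℚ-ring
  sumTo-ratio-bound u (suc j) ratio = begin
    sumTo (suc j) u + u (suc j) + 2 * u (suc j)  ≡⟨ lemma (sumTo (suc j) u) (u (suc j)) ⟩
    sumTo (suc j) u + 3 * u (suc j)              ≤⟨ +-monoʳ-≤ (sumTo (suc j) u) (ratio j (ℕ.n<1+n j)) ⟩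
    sumTo (suc j) u + 2 * u j                    ≤⟨ sumTo-ratio-bound u j (λ t → ratio t ∘ ℕ.m<n⇒m<1+n) ⟩
    3 * u 0                                      ∎
    where
    open ≤-Reasoning
    lemma : ∀ S a → S + a + 2 * a ≡ S + 3 * a
    lemma = solve-∀ ℚ-ring

  run-inv-ratio : ∀ {y K t} → 1 ℕ.≤ y → IsOddRun y K → t ℕ.< K →
                  3 * inv (iter (suc t) y) ≤ 2 * inv (iter t y)
  run-inv-ratio {t = t} y-pos run t<K =
    cross-≤ 3 2 (iter-pos y-pos t) (iter-pos y-pos (suc t)) (run-3≤2 run t<K)

  T-tail-bound : ∀ {y j} → 1 ℕ.≤ y → IsOddRun y (suc j) → T y (suc j) + 2 * inv (iter j y) ≤ 3 * inv y
  T-tail-bound {y} {j} y-pos run =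
    sumTo-ratio-bound (λ t → inv (iter t y)) j (λ t t<j → run-inv-ratio y-pos run (ℕ.m<n⇒m<1+n t<j))

  T<3/y : ∀ {y K} → 1 ℕ.≤ y → IsOddRun y K → T y K < 3 * inv y
  T<3/y {K = zero} _ (() , _)
  T<3/y {y} {suc j} y-pos run = begin-strict
    T y (suc j)                        ≡⟨ +-identityʳ (T y (suc j)) ⟨
    T y (suc j) + 0ℚ                   <⟨ +-monoʳ-< (T y (suc j)) (*-monoʳ-<-pos 2 (inv-pos (iter-pos y-pos j))) ⟩
    T y (suc j) + 2 * inv (iter j y)   ≤⟨ T-tail-bound y-pos run ⟩
    3 * inv y                          ∎
    where open ≤-Reasoning

  T-short : ∀ {y K} → 1 ℕ.≤ y → IsOddRun y K → K ℕ.≤ 2 → 3 * T y K ≤ 5 * inv y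
  T-short {K = zero} _ (() , _) _
  T-short {y} {suc zero} y-pos _ _ = begin
    3 * (0ℚ + inv y)  ≡⟨ lemma (inv y) ⟩
    3 * inv y         ≤⟨ cross-≤ 3 5 y-pos y-pos (ℕ.*-monoˡ-≤ y {3} {5} (s≤s (s≤s (s≤s z≤n)))) ⟩
    5 * inv y         ∎
    where
    open ≤-Reasoning
    lemma : ∀ a → 3 * (0ℚ + a) ≡ 3 * a
    lemma = solve-∀ ℚ-ring
  T-short {y} {suc (suc zero)} y-pos run _ = begin
    3 * (0ℚ + inv y + inv (C y))  ≡⟨ lemma₁ (inv y) (inv (C y)) ⟩
    3 * inv y + 3 * inv (C y)     ≤⟨ +-monoʳ-≤ (3 * inv y) (run-inv-ratio y-pos run (s≤s z≤n)) ⟩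
    3 * inv y + 2 * inv y         ≡⟨ lemma₂ (inv y) ⟩
    5 * inv y                     ∎
    where
    open ≤-Reasoning
    lemma₁ : ∀ a b → 3 * (0ℚ + a + b) ≡ 3 * a + 3 * b
    lemma₁ = solve-∀ ℚ-ring
    lemma₂ : ∀ a → 3 * a + 2 * a ≡ 5 * a
    lemma₂ = solve-∀ ℚ-ring
  T-short {K = suc (suc (suc _))} _ _ (s≤s (s≤s ()))

  T-long-pair : ∀ {y K T′} → 1 ℕ.≤ y → IsOddRun y K → 3 ℕ.≤ K → T′ ≤ 3 * inv (iter (suc K) y) →
                9 * (T y K + T′) ≤ 35 * inv y
  T-long-pair {y} {suc (suc (suc j))} {T′} y-pos run _ T′-bound = begin
    9 * (T y K + T′)                   ≤⟨ *-monoˡ-≤-nonNeg 9 (+-monoʳ-≤ (T y K) T′≤4w) ⟩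
    9 * (T y K + 4 * w)                ≡⟨ lemma₁ (T y K) w ⟩
    9 * (T y K + 2 * w) + 2 * (9 * w)  ≤⟨ +-mono-≤ (*-monoˡ-≤-nonNeg 9 (T-tail-bound y-pos run))
                                                   (*-monoˡ-≤-nonNeg 2 9w≤4/y) ⟩
    9 * (3 * inv y) + 2 * (4 * inv y)  ≡⟨ lemma₂ (inv y) ⟩
    35 * inv y                         ∎
    where
    open ≤-Reasoning
    K : ℕ
    K = 3 ℕ.+ j
    w : ℚ
    w = inv (iter (2 ℕ.+ j) y)
    9w≤4/y : 9 * w ≤ 4 * inv y
    9w≤4/y = cross-≤ 9 4 y-pos (iter-pos y-pos (2 ℕ.+ j))
      (ℕ.≤-trans (run-9≤4 run (s≤s (s≤s (s≤s z≤n))))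
                 (ℕ.*-monoʳ-≤ 4 (run-mono run (ℕ.m≤m+n 2 j) (ℕ.n<1+n (2 ℕ.+ j)))))
    T′≤4w : T′ ≤ 4 * w
    T′≤4w = ≤-trans T′-bound (cross-≤ 3 4 (iter-pos y-pos (2 ℕ.+ j)) (iter-pos y-pos (suc K)) (run-end run))
    lemma₁ : ∀ a b → 9 * (a + 4 * b) ≡ 9 * (a + 2 * b) + 2 * (9 * b)
    lemma₁ = solve-∀ ℚ-ring
    lemma₂ : ∀ a → 9 * (3 * a) + 2 * (4 * a) ≡ 35 * a
    lemma₂ = solve-∀ ℚ-ring
  T-long-pair {K = zero} _ _ ()
  T-long-pair {K = suc zero} _ _ (s≤s ())
  T-long-pair {K = suc (suc zero)} _ _ (s≤s (s≤s ()))

  T-large-start : ∀ {y K X} → 1 ℕ.≤ X → 1 ℕ.≤ y → IsOddRun y K → 9 ℕ.* X ℕ.≤ 5 ℕ.* y →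
                  3 * T y K ≤ 5 * inv X
  T-large-start {y} {K} {X} X-pos y-pos run 9X≤5y = begin
    3 * T y K        ≤⟨ *-monoˡ-≤-nonNeg 3 (<⇒≤ (T<3/y y-pos run)) ⟩
    3 * (3 * inv y)  ≡⟨ *-assoc 3 3 (inv y) ⟨
    9 * inv y        ≤⟨ cross-≤ 9 5 X-pos y-pos 9X≤5y ⟩
    5 * inv X        ∎
    where open ≤-Reasoning

  Light : ℚ → (ℕ → ℚ) → ℕ → Set
  Light I B i = 3 * B i ≤ 5 * I

  HeavyPair : ℚ → (ℕ → ℚ) → ℕ → Set
  HeavyPair I B i = B i < 3 * I × 9 * (B i + B (suc i)) ≤ 35 * I

  module _ {I : ℚ} (I-pos : 0ℚ < I) (B : ℕ → ℚ)
           (light-or-paired : ∀ i → Light I B i ⊎ HeavyPair I B i) where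

    private instance
      I-nonNeg : NonNegative I
      I-nonNeg = nonNegative (<⇒≤ I-pos)

    Balanced : ℕ → Set
    Balanced m = 18 * sumTo m B ≤ fromℕ (35 ℕ.* m) * I

    data Progress : ℕ → Set where
      balanced : ∀ {m} → Balanced m → Progress m
      pending  : ∀ {m} → Balanced m → HeavyPair I B m → Progress (suc m)

    fromℕ-35*suc : ∀ m → fromℕ (35 ℕ.* suc m) * I ≡ fromℕ (35 ℕ.* m) * I + 35 * I
    fromℕ-35*suc m = begin
      fromℕ (35 ℕ.* suc m) * I        ≡⟨ cong (λ n → fromℕ n * I) (ℕ.*-suc 35 m) ⟩
      fromℕ (35 ℕ.+ 35 ℕ.* m) * I     ≡⟨ cong (_* I) (fromℕ-+ 35 (35 ℕ.* m)) ⟩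
      (35 + fromℕ (35 ℕ.* m)) * I     ≡⟨ lemma (fromℕ (35 ℕ.* m)) I ⟩
      fromℕ (35 ℕ.* m) * I + 35 * I   ∎
      where
      open ≡-Reasoning
      lemma : ∀ a b → (35 + a) * b ≡ a * b + 35 * b
      lemma = solve-∀ ℚ-ring

    balanced-light : ∀ {m} → Balanced m → Light I B m → Balanced (suc m)
    balanced-light {m} bal light = begin
      18 * (sumTo m B + B m)          ≡⟨ lemma₁ (sumTo m B) (B m) ⟩
      18 * sumTo m B + 6 * (3 * B m)  ≤⟨ +-mono-≤ bal (*-monoˡ-≤-nonNeg 6 light) ⟩
      M + 6 * (5 * I)                 ≡⟨ lemma₂ M I ⟩
      M + 30 * I                      ≤⟨ +-monoʳ-≤ M (*-monoʳ-≤-nonNeg I (from-yes (30 ≤? 35))) ⟩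
      M + 35 * I                      ≡⟨ fromℕ-35*suc m ⟨
      fromℕ (35 ℕ.* suc m) * I        ∎
      where
      open ≤-Reasoning
      M : ℚ
      M = fromℕ (35 ℕ.* m) * I
      lemma₁ : ∀ a b → 18 * (a + b) ≡ 18 * a + 6 * (3 * b)
      lemma₁ = solve-∀ ℚ-ring
      lemma₂ : ∀ a b → a + 6 * (5 * b) ≡ a + 30 * b
      lemma₂ = solve-∀ ℚ-ring

    balanced-pair : ∀ {m} → Balanced m → HeavyPair I B m → Balanced (suc (suc m))
    balanced-pair {m} bal (_ , pair) = begin
      18 * (sumTo m B + B m + B (suc m))            ≡⟨ lemma₁ (sumTo m B) (B m) (B (suc m)) ⟩
      18 * sumTo m B + 2 * (9 * (B m + B (suc m)))  ≤⟨ +-mono-≤ bal (*-monoˡ-≤-nonNeg 2 pair) ⟩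
      M + 2 * (35 * I)                              ≡⟨ lemma₂ M I ⟩
      M + 35 * I + 35 * I                           ≡⟨ cong (_+ 35 * I) (fromℕ-35*suc m) ⟨
      fromℕ (35 ℕ.* suc m) * I + 35 * I             ≡⟨ fromℕ-35*suc (suc m) ⟨
      fromℕ (35 ℕ.* suc (suc m)) * I                ∎
      where
      open ≤-Reasoning
      M : ℚ
      M = fromℕ (35 ℕ.* m) * I
      lemma₁ : ∀ a b c → 18 * (a + b + c) ≡ 18 * a + 2 * (9 * (b + c))
      lemma₁ = solve-∀ ℚ-ring
      lemma₂ : ∀ a b → a + 2 * (35 * b) ≡ a + 35 * b + 35 * b
      lemma₂ = solve-∀ ℚ-ring

    progress : ∀ m → Progress m
    progress zero = balanced (≤-reflexive (lemma I))
      where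
      lemma : ∀ a → 18 * 0ℚ ≡ 0ℚ * a
      lemma = solve-∀ ℚ-ring
    progress (suc m) with progress m
    ... | pending bal pair = balanced (balanced-pair bal pair)
    ... | balanced bal with light-or-paired m
    ...   | inj₁ light = balanced (balanced-light bal light)
    ...   | inj₂ pair = pending bal pair

    progress⇒bound : ∀ {m} → Progress m → 18 * sumTo m B < fromℕ (35 ℕ.* m ℕ.+ 19) * I
    progress⇒bound {m} (balanced bal) = begin-strict
      18 * sumTo m B                ≤⟨ bal ⟩
      M                             ≡⟨ +-identityʳ M ⟨
      M + 0ℚ                        <⟨ +-monoʳ-< M (*-monoʳ-<-pos 19 I-pos) ⟩
      M + 19 * I                    ≡⟨ lemma (fromℕ (35 ℕ.* m)) I ⟩
      (fromℕ (35 ℕ.* m) + 19) * I   ≡⟨ cong (_* I) (fromℕ-+ (35 ℕ.* m) 19) ⟨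
      fromℕ (35 ℕ.* m ℕ.+ 19) * I   ∎
      where
      open ≤-Reasoning
      M : ℚ
      M = fromℕ (35 ℕ.* m) * I
      lemma : ∀ a b → a * b + 19 * b ≡ (a + 19) * b
      lemma = solve-∀ ℚ-ring
    progress⇒bound (pending {m} bal (heavy , _)) = begin-strict
      18 * (sumTo m B + B m)                   ≡⟨ *-distribˡ-+ 18 (sumTo m B) (B m) ⟩
      18 * sumTo m B + 18 * B m                <⟨ +-mono-≤-< bal (*-monoʳ-<-pos 18 heavy) ⟩
      fromℕ (35 ℕ.* m) * I + 18 * (3 * I)      ≡⟨ lemma (fromℕ (35 ℕ.* m)) I ⟩
      (fromℕ (35 ℕ.* m) + 54) * I              ≡⟨ cong (_* I) (fromℕ-+ (35 ℕ.* m) 54) ⟨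
      fromℕ (35 ℕ.* m ℕ.+ 54) * I              ≡⟨ cong (λ n → fromℕ n * I) (arith m) ⟩
      fromℕ (35 ℕ.* suc m ℕ.+ 19) * I          ∎
      where
      open ≤-Reasoning
      lemma : ∀ a b → a * b + 18 * (3 * b) ≡ (a + 54) * b
      lemma = solve-∀ ℚ-ring
      arith : ∀ m → 35 ℕ.* m ℕ.+ 54 ≡ 35 ℕ.* suc m ℕ.+ 19
      arith = ℕ-Ring.solve-∀

    sumTo-bound : ∀ m → sumTo m B < (+ (35 ℕ.* m ℕ.+ 19) / 18) * I
    sumTo-bound m = begin-strict
      sumTo m B                       ≡⟨ lemma₁ (sumTo m B) ⟩
      inv 18 * (18 * sumTo m B)       <⟨ *-monoʳ-<-pos (inv 18) (progress⇒bound (progress m)) ⟩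
      inv 18 * (fromℕ N * I)          ≡⟨ lemma₂ (fromℕ N) I ⟩
      fromℕ N * inv 18 * I            ≡⟨ cong (_* I) (fromℕ-*-inv N 17) ⟩
      (+ N / 18) * I                  ∎
      where
      open ≤-Reasoning
      N : ℕ
      N = 35 ℕ.* m ℕ.+ 19
      lemma₁ : ∀ a → a ≡ inv 18 * (18 * a)
      lemma₁ = solve-∀ ℚ-ring
      lemma₂ : ∀ a b → inv 18 * (a * b) ≡ a * inv 18 * b
      lemma₂ = solve-∀ ℚ-ring

open import Data.Nat using (ℕ; zero; suc; _+_; _*_; _<_; _≤_; _≤?_; _<?_; z≤n; s≤s)
open import Data.Nat.Properties
import Data.Nat.Tactic.RingSolver as ℕ-Ring
open Collatz
open Estimates

module Enumeration {S : ℕ → Set} {τ : ℕ → ℕ} (τ-< : ∀ i → τ i < τ (suc i))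
                   (τ-∈ : ∀ i → S (τ i)) (τ-onto : ∀ t → S t → ∃[ i ] τ i ≡ t) where

  τ-mono : ∀ {i j} → i ≤ j → τ i ≤ τ j
  τ-mono {j = zero} z≤n = ≤-refl
  τ-mono {i} {suc j} i≤j+1 with m≤n⇒m<n∨m≡n i≤j+1
  ... | inj₁ (s≤s i≤j) = ≤-trans (τ-mono i≤j) (<⇒≤ (τ-< j))
  ... | inj₂ refl = ≤-refl

  next-element : ∀ {i q} → S q → τ i < q → (∀ t → τ i < t → t < q → ¬ S t) → τ (suc i) ≡ q
  next-element {i} {q} q∈S τi<q gap = ≤-antisym τ[i+1]≤q q≤τ[i+1]
    where
    q≤τ[i+1] : q ≤ τ (suc i)
    q≤τ[i+1] = ≮⇒≥ (λ τ[i+1]<q → gap (τ (suc i)) (τ-< i) τ[i+1]<q (τ-∈ (suc i)))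
    τ[i+1]≤q : τ (suc i) ≤ q
    τ[i+1]≤q with τ-onto q q∈S
    ... | j , τj≡q with i <? j
    ...   | yes i<j = subst (τ (suc i) ≤_) τj≡q (τ-mono i<j)
    ...   | no i≮j = ⊥-elim (<-irrefl τj≡q (≤-<-trans (τ-mono (≮⇒≥ i≮j)) τi<q))

module Cycle {x p : ℕ} (on-cycle : OnCycle x p) (nontrivial : NonTrivial x) where

  iter-shift : ∀ s t → iter s (iter t x) ≡ iter (s + t) x
  iter-shift s t = sym (iter-+ s t x)

  cycle-pos : ∀ t → 1 ≤ iter t x
  cycle-pos = iter-pos (proj₁ on-cycle)

  periodic : ∀ t → iter (t + p) x ≡ iter t x
  periodic t = trans (iter-+ t p x) (cong (iter t) (proj₂ (proj₂ on-cycle)))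

  periodic* : ∀ q t → iter (t + q * p) x ≡ iter t x
  periodic* zero t = cong (λ s → iter s x) (+-identityʳ t)
  periodic* (suc q) t = begin
    iter (t + (p + q * p)) x  ≡⟨ cong (λ s → iter s x) (+-assoc t p (q * p)) ⟨
    iter (t + p + q * p) x    ≡⟨ periodic* q (t + p) ⟩
    iter (t + p) x            ≡⟨ periodic t ⟩
    iter t x                  ∎
    where open ≡-Reasoning

  1∉cycle : ∀ v → iter v x ≢ 1
  1∉cycle v v↦1 = nontrivial (in-orbit-of-1 , (v , v↦1) , (suc v , cong C v↦1))
    where
    v≤ : ∀ t → v ≤ t + v * p
    v≤ t = ≤-trans (≤-trans (≤-reflexive (sym (*-identityʳ v))) (*-monoʳ-≤ v (proj₁ (proj₂ on-cycle))))
                   (m≤n+m (v * p) t)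
    in-orbit-of-1 : ∀ t → iter t x ≡ 1 ⊎ iter t x ≡ 2
    in-orbit-of-1 t with m≤n⇒∃[o]m+o≡n (v≤ t)
    ... | d , v+d≡ = subst (λ n → n ≡ 1 ⊎ n ≡ 2) d↦t (orbit-of-1 d)
      where
      open ≡-Reasoning
      d↦t : iter d 1 ≡ iter t x
      d↦t = begin
        iter d 1            ≡⟨ cong (iter d) v↦1 ⟨
        iter d (iter v x)   ≡⟨ iter-shift d v ⟩
        iter (d + v) x      ≡⟨ cong (λ s → iter s x) (trans (+-comm d v) v+d≡) ⟩
        iter (t + v * p) x  ≡⟨ periodic* v t ⟩
        iter t x            ∎

  cycle-avoids-orbit-of-1 : ∀ v d → iter v x ≢ iter d 1
  cycle-avoids-orbit-of-1 v d meet with orbit-of-1 d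
  ... | inj₁ d↦1 = 1∉cycle v (trans meet d↦1)
  ... | inj₂ d↦2 = 1∉cycle (suc v) (cong C (trans meet d↦2))

  orbit-via-1-avoids-cycle : ∀ {w t} → iter t w ≡ 1 → ∀ s u → iter s w ≢ iter u x
  orbit-via-1-avoids-cycle {w} {t} t↦1 s u meet with ≤-total s t
  ... | inj₁ s≤t = let d , s+d≡t = m≤n⇒∃[o]m+o≡n s≤t in 1∉cycle (d + u) (begin
    iter (d + u) x     ≡⟨ iter-shift d u ⟨
    iter d (iter u x)  ≡⟨ cong (iter d) meet ⟨
    iter d (iter s w)  ≡⟨ iter-+ d s w ⟨
    iter (d + s) w     ≡⟨ cong (λ r → iter r w) (trans (+-comm d s) s+d≡t) ⟩
    iter t w           ≡⟨ t↦1 ⟩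
    1                  ∎)
    where open ≡-Reasoning
  ... | inj₂ t≤s = let d , t+d≡s = m≤n⇒∃[o]m+o≡n t≤s in cycle-avoids-orbit-of-1 u d (begin
    iter u x           ≡⟨ meet ⟨
    iter s w           ≡⟨ cong (λ r → iter r w) (trans (sym t+d≡s) (+-comm t d)) ⟩
    iter (d + t) w     ≡⟨ iter-+ d t w ⟩
    iter d (iter t w)  ≡⟨ cong (iter d) t↦1 ⟩
    iter d 1           ∎)
    where open ≡-Reasoning

  module _ {X₀ : ℕ} (reach : ∀ n → 1 ≤ n → n ≤ X₀ → ∃[ t ] iter t n ≡ 1) where

    orbit-meets-cycle⇒> : ∀ w s u → iter s w ≡ iter u x → X₀ < w
    orbit-meets-cycle⇒> zero s u meet =
      contradiction (subst (1 ≤_) (trans (sym meet) (iter-of-0 s)) (cycle-pos u)) λ ()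
    orbit-meets-cycle⇒> (suc w) s u meet with suc w ≤? X₀
    ... | no w≰X₀ = ≰⇒> w≰X₀
    ... | yes w≤X₀ = let t , t↦1 = reach (suc w) (s≤s z≤n) w≤X₀
                     in ⊥-elim (orbit-via-1-avoids-cycle {t = t} t↦1 s u meet)

    cycle-above : ∀ t → X₀ < iter t x
    cycle-above t = orbit-meets-cycle⇒> (iter t x) 0 t refl

  -- The predecessor index suc t + p ∸ 1 of position suc t reduces to t + p.
  local-min-after-even : ∀ t → Even (iter t x) → Odd (iter (suc t) x) → IsLocalMinAt x p (suc t)
  local-min-after-even t e o =
    subst (iter (suc t) x <_) (sym (periodic t)) (even⇒C< {iter t x} e (cycle-pos t)) ,
    odd⇒<C {iter (suc t) x} o

  ¬local-min-after-odd : ∀ t → Odd (iter t x) → ¬ IsLocalMinAt x p (suc t)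
  ¬local-min-after-odd t o (below-pred , _) =
    <-asym (odd⇒<C {iter t x} o) (subst (C (iter t x) <_) (periodic t) below-pred)

module Classification {X₀ x p : ℕ} (X₀-pos : 1 ≤ X₀)
  (reach : ∀ n → 1 ≤ n → n ≤ X₀ → ∃[ t ] iter t n ≡ 1)
  (on-cycle : OnCycle x p) (nontrivial : NonTrivial x)
  {τ : ℕ → ℕ} (τ-< : ∀ i → τ i < τ (suc i)) (τ-min : ∀ i → IsLocalMinAt x p (τ i))
  (τ-onto : ∀ t → IsLocalMinAt x p t → ∃[ i ] τ i ≡ t)
  {k : ℕ → ℕ} (runs : ∀ i → IsOddRun (iter (τ i) x) (k i)) where

  open import Agda.Builtin.FromNat using (fromNat)
  open import Data.Unit.Base using (tt)
  import Data.Rational.Properties as ℚₚ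
  open Cycle on-cycle nontrivial
  open Enumeration τ-< τ-min τ-onto

  n : ℕ → ℕ
  n i = iter (τ i) x

  B : ℕ → ℚ
  B i = T (n i) (k i)

  n-pos : ∀ i → 1 ≤ n i
  n-pos i = cycle-pos (τ i)

  X₀≤n : ∀ i → X₀ ≤ n i
  X₀≤n i = <⇒≤ (cycle-above reach (τ i))

  next-local-min : ∀ i → Odd (iter (suc (k i)) (n i)) → n (suc i) ≡ iter (suc (k i)) (n i)
  next-local-min i odd-after = trans (cong (λ s → iter s x) τ[i+1]≡) (sym (iter-shift (suc (k i)) (τ i)))
    where
    min-after : IsLocalMinAt x p (suc (k i + τ i))
    min-after = local-min-after-even (k i + τ i)
                  (subst Even (iter-shift (k i) (τ i)) (proj₂ (proj₂ (runs i))))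
                  (subst Odd (iter-shift (suc (k i)) (τ i)) odd-after)
    no-min-inside : ∀ t → τ i < t → t < suc (k i + τ i) → ¬ IsLocalMinAt x p t
    no-min-inside (suc t) (s≤s τi≤t) (s≤s t<) with m≤n⇒∃[o]m+o≡n τi≤t
    ... | d , refl = ¬local-min-after-odd (τ i + d) (subst Odd n↦τi+d (proj₁ (proj₂ (runs i)) d d<k))
      where
      n↦τi+d : iter d (n i) ≡ iter (τ i + d) x
      n↦τi+d = trans (iter-shift d (τ i)) (cong (λ s → iter s x) (+-comm d (τ i)))
      d<k : d < k i
      d<k = +-cancelˡ-< (τ i) d (k i) (subst (τ i + d <_) (+-comm (k i) (τ i)) t<)
    τ[i+1]≡ : τ (suc i) ≡ suc (k i + τ i)
    τ[i+1]≡ = next-element min-after (s≤s (m≤n+m (τ i) (k i))) no-min-inside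

  half-above : ∀ i z → n i ≡ 1 + 2 * z → Even (iter (suc (k i)) (n i)) → X₀ < z
  half-above i z n≡1+2z even-after = orbit-meets-cycle⇒> reach z (suc (k i)) (suc (suc (k i)) + τ i) (begin
    iter (suc (k i)) z                  ≡⟨ orbit-of-half-merges z (subst (λ y → IsOddRun y (k i)) n≡1+2z (runs i))
                                                                (subst (Even ∘ iter (suc (k i))) n≡1+2z even-after) ⟩
    iter (suc (suc (k i))) (1 + 2 * z)  ≡⟨ cong (iter (suc (suc (k i)))) n≡1+2z ⟨
    iter (suc (suc (k i))) (n i)        ≡⟨ iter-shift (suc (suc (k i))) (τ i) ⟩
    iter (suc (suc (k i)) + τ i) x      ∎)
    where open ≡-Reasoning

  light-if-even-after : ∀ i → Even (iter (suc (k i)) (n i)) → Light (inv X₀) B i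
  light-if-even-after i even-after with odd⇒1+2* {n i} (proj₁ (proj₂ (runs i)) 0 (proj₁ (runs i)))
  ... | z , n≡1+2z = T-large-start X₀-pos (n-pos i) (runs i) (begin
    9 * X₀           ≤⟨ *-monoˡ-≤ X₀ {9} {10} (n≤1+n 9) ⟩
    10 * X₀          ≤⟨ *-monoʳ-≤ 10 (<⇒≤ (half-above i z n≡1+2z even-after)) ⟩
    10 * z           ≤⟨ m≤n+m (10 * z) 5 ⟩
    5 + 10 * z       ≡⟨ lemma z ⟩
    5 * (1 + 2 * z)  ≡⟨ cong (5 *_) n≡1+2z ⟨
    5 * n i          ∎)
    where
    open ≤-Reasoning
    lemma : ∀ z → 5 + 10 * z ≡ 5 * (1 + 2 * z)
    lemma = ℕ-Ring.solve-∀

  light-or-paired-if-odd-after : ∀ i → Odd (iter (suc (k i)) (n i)) →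
                                 Light (inv X₀) B i ⊎ HeavyPair (inv X₀) B i
  light-or-paired-if-odd-after i odd-after with k i ≤? 2
  ... | yes short = inj₁ (ℚₚ.≤-trans (T-short (n-pos i) (runs i) short) (*inv-antitone 5 X₀-pos (X₀≤n i)))
  ... | no long = inj₂ ( ℚₚ.<-≤-trans (T<3/y (n-pos i) (runs i)) (*inv-antitone 3 X₀-pos (X₀≤n i))
                       , ℚₚ.≤-trans (T-long-pair (n-pos i) (runs i) (≰⇒> long) next-bound)
                                    (*inv-antitone 35 X₀-pos (X₀≤n i)) )
    where
    next-bound : B (suc i) ℚ.≤ 3 ℚ.* inv (iter (suc (k i)) (n i))
    next-bound = subst (λ m → B (suc i) ℚ.≤ 3 ℚ.* inv m) (next-local-min i odd-after)
                       (ℚₚ.<⇒≤ (T<3/y (n-pos (suc i)) (runs (suc i))))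

  light-or-paired : ∀ i → Light (inv X₀) B i ⊎ HeavyPair (inv X₀) B i
  light-or-paired i with even⊎odd (iter (suc (k i)) (n i))
  ... | inj₁ even-after = inj₁ (light-if-even-after i even-after)
  ... | inj₂ odd-after = light-or-paired-if-odd-after i odd-after

lemma12 : (X₀ : ℕ) → 765 < X₀
    → (∀ n → 1 ≤ n → n ≤ X₀ → ∃[ t ] iter t n ≡ 1)
    → (x p : ℕ) → OnCycle x p → NonTrivial x
    → (τ : ℕ → ℕ) → τ 0 ≡ 0
    → (∀ i → τ i < τ (suc i))
    → (∀ i → IsLocalMinAt x p (τ i))
    → (∀ t → IsLocalMinAt x p t → ∃[ i ] τ i ≡ t)
    → (k : ℕ → ℕ) → (∀ i → IsOddRun (iter (τ i) x) (k i))
    → (m₁ : ℕ)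
    → sumTo m₁ (λ i → T (iter (τ i) x) (k i))
      ℚ.< ((+ (35 * m₁ + 19) ℚ./ 18) ℚ.* inv X₀)
lemma12 X₀ 765<X₀ reach x p on-cycle nontrivial τ _ τ-< τ-min τ-onto k runs =
  sumTo-bound (inv-pos X₀-pos) B light-or-paired
  where
  X₀-pos : 1 ≤ X₀
  X₀-pos = ≤-trans (s≤s z≤n) 765<X₀
  open Classification X₀-pos reach on-cycle nontrivial τ-< τ-min τ-onto runs
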